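{- Let $G$ be a connected, triangle-free graph of order $n$ and size $m$. Then \[ \rho(G) \leq \frac{n}{2} + 2 - \frac{2m}{n-1}. \]
   Context: All graphs are finite and simple. For a connected graph $G$ of order $n\ge 2$ and a vertex $v$, $\overline{\sigma}_G(v)=\frac{1}{n-1}\sum_{w\in V(G)} d_G(v,w)$; the remoteness is $\rho(G)=\max_{v}\overline{\sigma}_G(v)$. Size means number of edges. A graph is triangle-free if it contains no subgraph isomorphic to $K_3$. -}

module Defs where

open import Data.Nat using (ℕ; zero; suc; _<_; _∸_) renaming (_+_ to _+ℕ_)
open import Data.Bool using (Bool; true; false; T)
open import Data.Fin using (Fin; toℕ)
open import Data.List using (List; map; foldr; allFin; concatMap)
open import Data.Nat.ListAction using (sum)
open import Data.Product using (_×_; ∃)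
open import Data.Integer using (+_)
open import Data.Rational using (ℚ; 0ℚ; _/_; _⊔_)
open import Relation.Nullary using (¬_)
open import Relation.Nullary.Decidable using (⌊_⌋)
open import Relation.Binary.PropositionalEquality using (_≡_)
import Data.Nat as ℕ

record SimpleGraph (n : ℕ) : Set where
  field
    adj     : Fin n → Fin n → Bool
    symm    : ∀ u v → adj u v ≡ adj v u
    irrefl  : ∀ v → adj v v ≡ false
open SimpleGraph public

Adj : ∀ {n} → SimpleGraph n → Fin n → Fin n → Set
Adj G u v = T (adj G u v)

data Walk {n : ℕ} (G : SimpleGraph n) : Fin n → Fin n → ℕ → Set where
  nil  : ∀ {v} → Walk G v v 0
  cons : ∀ {u v w k} → Adj G u v → Walk G v w k → Walk G u w (suc k)

Connected : ∀ {n} → SimpleGraph n → Set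
Connected G = ∀ u v → ∃ λ k → Walk G u v k

IsDistance : ∀ {n} → SimpleGraph n → Fin n → Fin n → ℕ → Set
IsDistance G u v d = Walk G u v d × (∀ k → Walk G u v k → d ℕ.≤ k)

TriangleFree : ∀ {n} → SimpleGraph n → Set
TriangleFree G = ∀ a b c → ¬ (Adj G a b × Adj G b c × Adj G a c)

bit : Bool → ℕ
bit true  = 1
bit false = 0

size : ∀ {n} → SimpleGraph n → ℕ
size {n} G = sum (concatMap (λ u → map (λ v →
  bit (⌊ toℕ u ℕ.<? toℕ v ⌋ Data.Bool.∧ adj G u v)) (allFin n)) (allFin n))

-- a / b as a rational (junk value 0 when b = 0; never used since n ≥ 2).
_/ℕ_ : ℕ → ℕ → ℚ
a /ℕ zero  = 0ℚ
a /ℕ suc b = (+ a) / suc b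

avgDist : ∀ {n} → (Fin n → Fin n → ℕ) → Fin n → ℚ
avgDist {n} d v = sum (map (d v) (allFin n)) /ℕ (n ∸ 1)

-- Remoteness: maximum of the average distances (all values are ≥ 0, so
-- starting the fold at 0 is harmless).
remoteness : ∀ {n} → (Fin n → Fin n → ℕ) → ℚ
remoteness {n} d = foldr _⊔_ 0ℚ (map (avgDist d) (allFin n))

{-# OPTIONS --safe #-}
-- For a vertex v with σ(v) = Σ_w d(v, w), the bound at v reads 2 (σ(v) + 2m) ≤ (n − 1)(n + 4).
-- We prove this for every BFS layering δ from v of a triangle-free graph, by induction on n:
-- delete a vertex u ≠ v that is deletable (each child of u has another parent, so δ stays a
-- BFS layering) and light (2 deg u + δ u ≤ n + 1).  Since neighbourhoods of adjacent vertices
-- are disjoint, adjacent a, b whose neighbours all have depth ≥ j satisfy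
-- deg a + deg b ≤ #{depth ≥ j} ≤ n − j.  Hence if no deepest vertex is light, every neighbour
-- of a deepest vertex lies one level closer to v, the parent p of a deepest vertex is light, and p is
-- deletable, for a deepest child whose only parent is p would have degree 1 and be light.
module Submission where

open import Defs
open import Data.Nat using (ℕ; _≤_; _∸_; _*_)
open import Data.Fin using (Fin)
open import Data.Rational using (ℚ) renaming (_≤_ to _≤ℚ_; _+_ to _+ℚ_; _-_ to _-ℚ_)

open import Data.Nat using (zero; suc; _+_; _<_; z≤n; s≤s; z<s; _≤?_; _<?_)
open import Data.Nat.Properties
open import Data.Nat.Tactic.RingSolver using (solve-∀)
open import Data.Nat.ListAction using (sum)
open import Data.Nat.ListAction.Properties using (sum-++)
open import Data.Fin as F using (zero; suc; punchIn; punchOut; toℕ)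
open import Data.Fin.Properties using (punchIn-injective; punchInᵢ≢i; punchIn-punchOut; toℕ-injective; any?; all?; ¬∀⟶∃¬)
open import Algebra.Properties.CommutativeMonoid.Sum +-0-commutativeMonoid
  using (sum-syntax; sum-cong-≗; sum-remove; ∑-distrib-+; ∑-comm; sum-replicate-zero)
  renaming (sum to ∑)
import Data.Integer as ℤ
import Data.Integer.Properties as ZP
import Data.Rational as Q
open import Data.Rational using (0ℚ)
import Data.Rational.Properties as QP
import Data.Rational.Unnormalised as U
open import Data.Rational.Unnormalised using (mkℚᵘ)
import Data.Rational.Unnormalised.Properties as UP
open import Data.Bool using (true; false; T; _∧_; T?)
open import Data.Bool.Properties using (T-≡)
open import Data.List using (List; []; _∷_; map; foldr; allFin; concatMap; tabulate)
open import Data.List.Properties using (map-tabulate)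
open import Data.List.Extrema.Nat using (argmax; f[xs]≤f[argmax])
open import Data.List.Membership.Propositional.Properties using (∈-allFin)
import Data.List.Relation.Unary.All as All
open import Data.Product using (_×_; _,_; ∃; proj₁; proj₂)
open import Relation.Nullary using (¬_; Dec; yes; no; contradiction)
open import Relation.Nullary.Decidable using (⌊_⌋; _×-dec_; _→-dec_)
open import Relation.Binary.PropositionalEquality using (_≡_; _≢_; refl; sym; trans; cong; cong₂; subst; subst₂; module ≡-Reasoning)
open import Function using (_∘_; id)
open import Function.Bundles using (Equivalence)

∑-mono-≤ : ∀ {n} {f g : Fin n → ℕ} → (∀ i → f i ≤ g i) → ∑ f ≤ ∑ g
∑-mono-≤ {zero}  f≤g = z≤n
∑-mono-≤ {suc n} f≤g = +-mono-≤ (f≤g zero) (∑-mono-≤ (f≤g ∘ suc))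

∑-mono-< : ∀ {n} {f g : Fin n → ℕ} → (∀ i → f i ≤ g i) → ∀ j → f j < g j → ∑ f < ∑ g
∑-mono-< {suc n} {f} {g} f≤g j fj<gj = begin-strict
  ∑ f                              ≡⟨ sum-remove {i = j} f ⟩
  f j + ∑ (f ∘ punchIn j)          <⟨ +-mono-<-≤ fj<gj (∑-mono-≤ (f≤g ∘ punchIn j)) ⟩
  g j + ∑ (g ∘ punchIn j)          ≡⟨ sum-remove {i = j} g ⟨
  ∑ g                              ∎
  where open ≤-Reasoning

∑-const-1 : ∀ n → ∑[ i < n ] 1 ≡ n
∑-const-1 zero    = refl
∑-const-1 (suc n) = cong suc (∑-const-1 n)

sum-tabulate : ∀ {n} (f : Fin n → ℕ) → sum (tabulate f) ≡ ∑ f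
sum-tabulate {zero}  f = refl
sum-tabulate {suc n} f = cong (f zero +_) (sum-tabulate (f ∘ suc))

sum-map-allFin : ∀ {n} (f : Fin n → ℕ) → sum (map f (allFin n)) ≡ ∑ f
sum-map-allFin f = trans (cong sum (map-tabulate id f)) (sum-tabulate f)

sum-concatMap : ∀ {A : Set} (h : A → List ℕ) (xs : List A) → sum (concatMap h xs) ≡ sum (map (sum ∘ h) xs)
sum-concatMap h []       = refl
sum-concatMap h (x ∷ xs) = trans (sum-++ (h x) _) (cong (sum (h x) +_) (sum-concatMap h xs))

∑-supported : ∀ {n} {f : Fin n → ℕ} p → (∀ i → i ≢ p → f i ≡ 0) → ∑ f ≡ f p
∑-supported {suc n} {f} p vanishes = begin
  ∑ f                      ≡⟨ sum-remove {i = p} f ⟩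
  f p + ∑ (f ∘ punchIn p)  ≡⟨ cong (f p +_) (sum-cong-≗ (λ i → vanishes (punchIn p i) (punchInᵢ≢i p i))) ⟩
  f p + ∑[ i < n ] 0       ≡⟨ cong (f p +_) (sum-replicate-zero n) ⟩
  f p + 0                  ≡⟨ +-identityʳ (f p) ⟩
  f p                      ∎
  where open ≡-Reasoning

bit≤1 : ∀ b → bit b ≤ 1
bit≤1 true  = ≤-refl
bit≤1 false = z≤n

bit-≤?-≡1 : ∀ {j m} → j ≤ m → bit ⌊ j ≤? m ⌋ ≡ 1
bit-≤?-≡1 {j} {m} j≤m with j ≤? m
... | yes _   = refl
... | no j≰m = contradiction j≤m j≰m

bit-≤?-≡0 : ∀ {j m} → m < j → bit ⌊ j ≤? m ⌋ ≡ 0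
bit-≤?-≡0 {j} {m} m<j with j ≤? m
... | yes j≤m = contradiction j≤m (<⇒≱ m<j)
... | no _    = refl

bit-≤?-antitone : ∀ j m → bit ⌊ suc j ≤? m ⌋ ≤ bit ⌊ j ≤? m ⌋
bit-≤?-antitone j m with suc j ≤? m
... | yes 1+j≤m = ≤-reflexive (sym (bit-≤?-≡1 (≤-trans (n≤1+n j) 1+j≤m)))
... | no _      = z≤n

module _ {n : ℕ} (G : SimpleGraph n) where

  Adj-sym : ∀ {a b} → Adj G a b → Adj G b a
  Adj-sym {a} {b} = subst T (symm G a b)

  degree : Fin n → ℕ
  degree a = ∑[ z < n ] bit (adj G a z)

  degreeSum : ℕ
  degreeSum = ∑ degree

  degree≤1 : ∀ {a p} → (∀ z → Adj G a z → z ≡ p) → degree a ≤ 1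
  degree≤1 {a} {p} nbrs≡p = begin
    degree a          ≡⟨ ∑-supported p non-neighbour ⟩
    bit (adj G a p)   ≤⟨ bit≤1 _ ⟩
    1                 ∎
    where
    open ≤-Reasoning
    non-neighbour : ∀ z → z ≢ p → bit (adj G a z) ≡ 0
    non-neighbour z z≢p with adj G a z in az
    ... | true  = contradiction (nbrs≡p z (subst T (sym az) _)) z≢p
    ... | false = refl

  private
    adjBelow : Fin n → Fin n → ℕ
    adjBelow a b = bit (⌊ toℕ a <? toℕ b ⌋ ∧ adj G a b)

    bit-adj-split : ∀ a b → bit (adj G a b) ≡ adjBelow a b + adjBelow b a
    bit-adj-split a b with toℕ a <? toℕ b | toℕ b <? toℕ a
    ... | yes a<b | yes b<a = contradiction b<a (<-asym a<b)
    ... | yes _   | no _    = sym (+-identityʳ _)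
    ... | no _    | yes _   = cong bit (symm G a b)
    ... | no a≮b  | no b≮a with toℕ-injective (≤-antisym (≮⇒≥ b≮a) (≮⇒≥ a≮b))
    ...   | refl = cong bit (irrefl G a)

    size-∑ : size G ≡ ∑[ a < n ] ∑[ b < n ] adjBelow a b
    size-∑ = begin
      size G                                            ≡⟨ sum-concatMap _ (allFin n) ⟩
      sum (map (λ a → sum (map (adjBelow a) (allFin n))) (allFin n))
                                                        ≡⟨ sum-map-allFin (λ a → sum (map (adjBelow a) (allFin n))) ⟩
      ∑[ a < n ] sum (map (adjBelow a) (allFin n))      ≡⟨ sum-cong-≗ (sum-map-allFin ∘ adjBelow) ⟩
      ∑[ a < n ] ∑[ b < n ] adjBelow a b                ∎
      where open ≡-Reasoning

  handshake : degreeSum ≡ 2 * size G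
  handshake = begin
    ∑[ a < n ] ∑[ b < n ] bit (adj G a b)
      ≡⟨ sum-cong-≗ (λ a → trans (sum-cong-≗ (bit-adj-split a)) (∑-distrib-+ (adjBelow a) (λ b → adjBelow b a))) ⟩
    ∑[ a < n ] (∑[ b < n ] adjBelow a b + ∑[ b < n ] adjBelow b a)
      ≡⟨ ∑-distrib-+ (λ a → ∑[ b < n ] adjBelow a b) (λ a → ∑[ b < n ] adjBelow b a) ⟩
    ∑[ a < n ] ∑[ b < n ] adjBelow a b + ∑[ a < n ] ∑[ b < n ] adjBelow b a
      ≡⟨ cong₂ _+_ (sym size-∑) (trans (∑-comm (λ a b → adjBelow b a)) (sym size-∑)) ⟩
    size G + size G
      ≡⟨ cong (size G +_) (sym (+-identityʳ (size G))) ⟩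
    2 * size G
      ∎
    where open ≡-Reasoning

removeVertex : ∀ {n} → SimpleGraph (suc n) → Fin (suc n) → SimpleGraph n
removeVertex G u = record
  { adj    = λ a b → adj G (punchIn u a) (punchIn u b)
  ; symm   = λ a b → symm G (punchIn u a) (punchIn u b)
  ; irrefl = λ a → irrefl G (punchIn u a)
  }

TriangleFree-removeVertex : ∀ {n} {G : SimpleGraph (suc n)} u → TriangleFree G → TriangleFree (removeVertex G u)
TriangleFree-removeVertex u tf a b c = tf (punchIn u a) (punchIn u b) (punchIn u c)

degreeSum-removeVertex : ∀ {n} (G : SimpleGraph (suc n)) u →
                         degreeSum G ≡ degreeSum (removeVertex G u) + 2 * degree G u
degreeSum-removeVertex {n} G u = begin
  degreeSum G
    ≡⟨ sum-remove {i = u} (degree G) ⟩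
  degree G u + ∑[ i < n ] degree G (punchIn u i)
    ≡⟨ cong (degree G u +_) (sum-cong-≗ (λ i → sum-remove {i = u} (A (punchIn u i)))) ⟩
  degree G u + ∑[ i < n ] (A (punchIn u i) u + ∑[ j < n ] A (punchIn u i) (punchIn u j))
    ≡⟨ cong (degree G u +_) (∑-distrib-+ (λ i → A (punchIn u i) u) (degree (removeVertex G u))) ⟩
  degree G u + (∑[ i < n ] A (punchIn u i) u + degreeSum (removeVertex G u))
    ≡⟨ cong (λ t → degree G u + (t + degreeSum (removeVertex G u))) column-u ⟩
  degree G u + (degree G u + degreeSum (removeVertex G u))
    ≡⟨ regroup (degree G u) (degreeSum (removeVertex G u)) ⟩
  degreeSum (removeVertex G u) + 2 * degree G u
    ∎
  where
  open ≡-Reasoning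
  A : Fin (suc n) → Fin (suc n) → ℕ
  A a b = bit (adj G a b)
  regroup : ∀ d D → d + (d + D) ≡ D + 2 * d
  regroup = solve-∀
  column-u : ∑[ i < n ] A (punchIn u i) u ≡ degree G u
  column-u = begin
    ∑[ i < n ] A (punchIn u i) u      ≡⟨ sum-cong-≗ (λ i → cong bit (symm G (punchIn u i) u)) ⟩
    ∑[ i < n ] A u (punchIn u i)      ≡⟨ cong (_+ ∑[ i < n ] A u (punchIn u i)) (cong bit (irrefl G u)) ⟨
    A u u + ∑[ i < n ] A u (punchIn u i) ≡⟨ sum-remove {i = u} (A u) ⟨
    degree G u                        ∎

module _ {n : ℕ} (G : SimpleGraph n) (δ : Fin n → ℕ) where

  Parent : Fin n → Fin n → Set
  Parent x w = Adj G w x × suc (δ x) ≡ δ w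

  parent? : ∀ x w → Dec (Parent x w)
  parent? x w = T? (adj G w x) ×-dec (suc (δ x) ≟ δ w)

  SoleParent : Fin n → Fin n → Set
  SoleParent p w = Parent p w × (∀ y → Parent y w → y ≡ p)

  Deletable : Fin n → Set
  Deletable u = ∀ w → Parent u w → ∃ λ y → y ≢ u × Parent y w

  ¬SoleParent⇒Deletable : ∀ u → ¬ (∃ λ w → SoleParent u w) → Deletable u
  ¬SoleParent⇒Deletable u no-sole w u-w
    with ¬∀⟶∃¬ n _ (λ y → parent? y w →-dec (y F.≟ u)) (λ sole → no-sole (w , u-w , sole))
  ... | y , ¬[y-w⇒y≡u] with parent? y w
  ...   | yes y-w = y , (λ y≡u → ¬[y-w⇒y≡u] (λ _ → y≡u)) , y-w
  ...   | no ¬y-w = contradiction (λ y-w → contradiction y-w ¬y-w) ¬[y-w⇒y≡u]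

  soleParent? : ∀ p → Dec (∃ λ w → SoleParent p w)
  soleParent? p = any? (λ w → parent? p w ×-dec all? (λ y → parent? y w →-dec (y F.≟ p)))

record IsBFSLayering {n : ℕ} (G : SimpleGraph n) (root : Fin n) (δ : Fin n → ℕ) : Set where
  field
    root-depth : δ root ≡ 0
    adj-depth  : ∀ a b → Adj G a b → δ a ≤ suc (δ b)
    parent     : ∀ w → w ≢ root → ∃ λ x → Parent G δ x w

module _ {n : ℕ} {G : SimpleGraph n} where

  Walk-snoc : ∀ {a b c k} → Walk G a b k → Adj G b c → Walk G a c (suc k)
  Walk-snoc nil         bc = cons bc nil
  Walk-snoc (cons ab p) bc = cons ab (Walk-snoc p bc)

  Walk-unsnoc : ∀ {a c k} → Walk G a c (suc k) → ∃ λ b → Walk G a b k × Adj G b c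
  Walk-unsnoc (cons ac nil)          = _ , nil , ac
  Walk-unsnoc (cons ab p@(cons _ _)) with Walk-unsnoc p
  ... | b , q , bc = b , cons ab q , bc

  Walk-last : ∀ {a c k} → a ≢ c → Walk G a c k → ∃ λ b → Adj G b c × ∃ λ k′ → Walk G a b k′ × suc k′ ≡ k
  Walk-last a≢c nil           = contradiction refl a≢c
  Walk-last _   p@(cons _ _) with Walk-unsnoc p
  ... | b , q , bc = b , bc , _ , q , refl

  distance-IsBFSLayering : (d : Fin n → Fin n → ℕ) → (∀ u v → IsDistance G u v (d u v)) →
                           ∀ v → IsBFSLayering G v (d v)
  distance-IsBFSLayering d isDist v = record
    { root-depth = n≤0⇒n≡0 (proj₂ (isDist v v) 0 nil)
    ; adj-depth  = adj-depth
    ; parent     = parent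
    }
    where
    adj-depth : ∀ a b → Adj G a b → d v a ≤ suc (d v b)
    adj-depth a b ab = proj₂ (isDist v a) _ (Walk-snoc (proj₁ (isDist v b)) (Adj-sym G ab))
    parent : ∀ w → w ≢ v → ∃ λ x → Parent G (d v) x w
    parent w w≢v with Walk-last (w≢v ∘ sym) (proj₁ (isDist v w))
    ... | x , xw , k′ , p , 1+k′≡dw = x , Adj-sym G xw ,
      ≤-antisym (subst (suc (d v x) ≤_) 1+k′≡dw (s≤s (proj₂ (isDist v x) k′ p)))
                (adj-depth w x (Adj-sym G xw))

removeVertex-IsBFSLayering : ∀ {n} {G : SimpleGraph (suc n)} {v δ} → IsBFSLayering G v δ →
                             ∀ {u} (u≢v : u ≢ v) → Deletable G δ u →
                             IsBFSLayering (removeVertex G u) (punchOut u≢v) (δ ∘ punchIn u)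
removeVertex-IsBFSLayering {G = G} {v} {δ} L {u} u≢v u-deletable = record
  { root-depth = trans (cong δ (punchIn-punchOut u≢v)) root-depth
  ; adj-depth  = λ a b → adj-depth (punchIn u a) (punchIn u b)
  ; parent     = parent′
  }
  where
  open IsBFSLayering L
  surviving-parent : ∀ {w y} → (y≢u : y ≢ u) → Parent G δ y (punchIn u w) →
                     Parent (removeVertex G u) (δ ∘ punchIn u) (punchOut (y≢u ∘ sym)) w
  surviving-parent {w} y≢u (wy , depth) rewrite punchIn-punchOut (y≢u ∘ sym) = wy , depth
  parent′ : ∀ w → w ≢ punchOut u≢v → ∃ λ x → Parent (removeVertex G u) (δ ∘ punchIn u) x w
  parent′ w w≢v′
    with parent (punchIn u w) (λ w≡v → w≢v′ (punchIn-injective u w _ (trans w≡v (sym (punchIn-punchOut u≢v)))))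
  ... | x , x-w with x F.≟ u
  ...   | no x≢u  = _ , surviving-parent x≢u x-w
  ...   | yes refl with u-deletable (punchIn u w) x-w
  ...     | y , y≢u , y-w = _ , surviving-parent y≢u y-w

module DeletableLightVertex {n : ℕ} (G : SimpleGraph n) (tf : TriangleFree G)
                            {v : Fin n} {δ : Fin n → ℕ} (L : IsBFSLayering G v δ) where
  open IsBFSLayering L

  depth-zero⇒root : ∀ {z} → δ z ≡ 0 → z ≡ v
  depth-zero⇒root {z} δz≡0 with z F.≟ v
  ... | yes z≡v = z≡v
  ... | no z≢v  = contradiction (trans (proj₂ (proj₂ (parent z z≢v))) δz≡0) 1+n≢0

  depth-attained : ∀ {j w} → j ≤ δ w → ∃ λ z → δ z ≡ j
  depth-attained {j} {w} j≤δw = descend (δ w ∸ j) w (sym (m∸n+n≡m j≤δw))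
    where
    descend : ∀ m w → δ w ≡ m + j → ∃ λ z → δ z ≡ j
    descend zero    w δw≡j     = w , δw≡j
    descend (suc m) w δw≡1+m+j with w F.≟ v
    ... | yes refl = contradiction (trans (sym δw≡1+m+j) root-depth) 1+n≢0
    ... | no w≢v with parent w w≢v
    ...   | x , _ , 1+δx≡δw = descend m x (suc-injective (trans 1+δx≡δw δw≡1+m+j))

  neighbour-depth : ∀ {t j} → δ t ≡ suc j → ∀ z → Adj G t z → j ≤ δ z
  neighbour-depth {t} δt≡1+j z tz = ≤-pred (subst (_≤ suc (δ z)) δt≡1+j (adj-depth t z tz))

  #depth≥ : ℕ → ℕ
  #depth≥ j = ∑[ z < n ] bit ⌊ j ≤? δ z ⌋

  #depth≥-decreasing : ∀ {z j} → δ z ≡ j → #depth≥ (suc j) < #depth≥ j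
  #depth≥-decreasing {z} {j} δz≡j = ∑-mono-< (λ y → bit-≤?-antitone j (δ y)) z (begin-strict
    bit ⌊ suc j ≤? δ z ⌋  ≡⟨ bit-≤?-≡0 (s≤s (≤-reflexive δz≡j)) ⟩
    0                     <⟨ z<s ⟩
    1                     ≡⟨ bit-≤?-≡1 (≤-reflexive (sym δz≡j)) ⟨
    bit ⌊ j ≤? δ z ⌋      ∎)
    where open ≤-Reasoning

  #depth≥-bound : ∀ {j t} → j ≤ suc (δ t) → #depth≥ j + j ≤ n
  #depth≥-bound {zero} _ = ≤-reflexive (begin
    #depth≥ 0 + 0    ≡⟨ +-identityʳ _ ⟩
    #depth≥ 0        ≡⟨ sum-cong-≗ {n} (λ z → bit-≤?-≡1 {m = δ z} z≤n) ⟩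
    ∑[ z < n ] 1     ≡⟨ ∑-const-1 n ⟩
    n                ∎)
    where open ≡-Reasoning
  #depth≥-bound {suc j} (s≤s j≤δt) with depth-attained j≤δt
  ... | z , δz≡j = begin
    #depth≥ (suc j) + suc j    ≡⟨ +-suc _ j ⟩
    suc (#depth≥ (suc j)) + j  ≤⟨ +-monoˡ-≤ j (#depth≥-decreasing δz≡j) ⟩
    #depth≥ j + j              ≤⟨ #depth≥-bound (m≤n⇒m≤1+n j≤δt) ⟩
    n                          ∎
    where open ≤-Reasoning

  degree+degree≤#depth≥ : ∀ {j a b} → Adj G a b →
                          (∀ z → Adj G a z → j ≤ δ z) → (∀ z → Adj G b z → j ≤ δ z) →
                          degree G a + degree G b ≤ #depth≥ j
  degree+degree≤#depth≥ {j} {a} {b} ab a-deep b-deep = begin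
    degree G a + degree G b                         ≡⟨ ∑-distrib-+ (bit ∘ adj G a) (bit ∘ adj G b) ⟨
    ∑[ z < n ] (bit (adj G a z) + bit (adj G b z))  ≤⟨ ∑-mono-≤ disjoint ⟩
    #depth≥ j                                       ∎
    where
    open ≤-Reasoning
    disjoint : ∀ z → bit (adj G a z) + bit (adj G b z) ≤ bit ⌊ j ≤? δ z ⌋
    disjoint z with adj G a z in az | adj G b z in bz
    ... | true  | true  = contradiction (ab , Equivalence.from T-≡ bz , Equivalence.from T-≡ az) (tf a b z)
    ... | true  | false = ≤-reflexive (sym (bit-≤?-≡1 (a-deep z (Equivalence.from T-≡ az))))
    ... | false | true  = ≤-reflexive (sym (bit-≤?-≡1 (b-deep z (Equivalence.from T-≡ bz))))
    ... | false | false = z≤n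

  Light : Fin n → Set
  Light t = 2 * degree G t + δ t ≤ suc n

  light? : ∀ t → Dec (Light t)
  light? t = 2 * degree G t + δ t ≤? suc n

  Light-from : ∀ {t j} → δ t ≡ suc j → 2 * degree G t + j ≤ n → Light t
  Light-from {t} {j} δt≡1+j bound = begin
    2 * degree G t + δ t       ≡⟨ cong (2 * degree G t +_) δt≡1+j ⟩
    2 * degree G t + suc j     ≡⟨ +-suc _ j ⟩
    suc (2 * degree G t + j)   ≤⟨ s≤s bound ⟩
    suc n                      ∎
    where open ≤-Reasoning

  ¬Light-bound : ∀ {t j} → ¬ Light t → δ t ≤ suc (suc j) → n ≤ 2 * degree G t + j
  ¬Light-bound {t} {j} heavy δt≤2+j = ≤-pred (≤-pred (begin
    suc (suc n)                    ≤⟨ ≰⇒> heavy ⟩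
    2 * degree G t + δ t           ≤⟨ +-monoʳ-≤ (2 * degree G t) δt≤2+j ⟩
    2 * degree G t + suc (suc j)   ≡⟨ trans (+-suc _ (suc j)) (cong suc (+-suc _ j)) ⟩
    suc (suc (2 * degree G t + j)) ∎))
    where open ≤-Reasoning

  -- Triangle-freeness gives deg t + deg x ≤ n − j; a heavy t leaves little room for deg x.
  neighbour-of-heavy : ∀ {j t x} → Adj G t x →
                       (∀ z → Adj G t z → j ≤ δ z) → (∀ z → Adj G x z → j ≤ δ z) →
                       n ≤ 2 * degree G t + j → 2 * degree G x + j ≤ n
  neighbour-of-heavy {j} {t} {x} tx t-deep x-deep t-heavy = +-cancelʳ-≤ n (2 * b + j) n (begin
    2 * b + j + n            ≤⟨ +-monoʳ-≤ (2 * b + j) t-heavy ⟩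
    2 * b + j + (2 * a + j)  ≡⟨ regroup a b j ⟩
    2 * (a + b + j)          ≤⟨ *-monoʳ-≤ 2 (+-monoˡ-≤ j (degree+degree≤#depth≥ tx t-deep x-deep)) ⟩
    2 * (#depth≥ j + j)      ≤⟨ *-monoʳ-≤ 2 (#depth≥-bound {t = x} (m≤n⇒m≤1+n (t-deep x tx))) ⟩
    2 * n                    ≡⟨ cong (n +_) (+-identityʳ n) ⟩
    n + n                    ∎)
    where
    open ≤-Reasoning
    a b : ℕ
    a = degree G t
    b = degree G x
    regroup : ∀ a b j → 2 * b + j + (2 * a + j) ≡ 2 * (a + b + j)
    regroup = solve-∀

  deepest : Fin n
  deepest = argmax δ v (allFin n)

  Top : Fin n → Set
  Top t = δ t ≡ δ deepest

  depth≤max : ∀ z → δ z ≤ δ deepest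
  depth≤max z = All.lookup (f[xs]≤f[argmax] v (allFin n)) (∈-allFin z)

  maxDepth<n : δ deepest < n
  maxDepth<n = m+n≤o⇒n≤o (#depth≥ (suc (δ deepest))) (#depth≥-bound {t = deepest} ≤-refl)

  degree≤1⇒Light : ∀ {t} → degree G t ≤ 1 → Light t
  degree≤1⇒Light {t} deg≤1 =
    ≤-trans (+-monoˡ-≤ (δ t) (*-monoʳ-≤ 2 deg≤1)) (s≤s (≤-<-trans (depth≤max t) maxDepth<n))

  Top⇒Deletable : ∀ {t} → Top t → Deletable G δ t
  Top⇒Deletable {t} t-top w (_ , 1+δt≡δw) = contradiction (begin
    suc (δ deepest)  ≡⟨ cong suc (sym t-top) ⟩
    suc (δ t)        ≡⟨ 1+δt≡δw ⟩
    δ w              ≤⟨ depth≤max w ⟩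
    δ deepest        ∎) 1+n≰n
    where open ≤-Reasoning

  module _ {w₀ : Fin n} (w₀≢v : w₀ ≢ v) where

    maxDepth-suc : ∃ λ j → δ deepest ≡ suc j
    maxDepth-suc with parent w₀ w₀≢v
    ... | x , _ , 1+δx≡δw₀ with δ deepest | depth≤max w₀
    ...   | suc j | _ = j , refl
    ...   | zero  | δw₀≤0 = contradiction (n≤0⇒n≡0 (subst (_≤ 0) (sym 1+δx≡δw₀) δw₀≤0)) 1+n≢0

    Top⇒≢root : ∀ {t} → Top t → t ≢ v
    Top⇒≢root t-top refl = 1+n≢0 (trans (sym (proj₂ maxDepth-suc)) (trans (sym t-top) root-depth))

    module NoLightTop (no-light-top : ∀ t → Top t → ¬ Light t) where

      top-neighbour-below : ∀ {t z} → Top t → Adj G t z → suc (δ z) ≡ δ t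
      top-neighbour-below {t} {z} t-top tz with maxDepth-suc
      ... | j , e≡1+j =
        ≤-antisym (≤∧≢⇒< (subst (δ z ≤_) (sym t-top) (depth≤max z)) δz≢δt) (adj-depth t z tz)
        where
        δt≡1+j : δ t ≡ suc j
        δt≡1+j = trans t-top e≡1+j
        δz≢δt : δ z ≢ δ t
        δz≢δt δz≡δt = no-light-top z (trans δz≡δt t-top) (Light-from (trans δz≡δt δt≡1+j)
          (neighbour-of-heavy tz (neighbour-depth δt≡1+j) (neighbour-depth (trans δz≡δt δt≡1+j))
            (¬Light-bound (no-light-top t t-top) (m≤n⇒m≤1+n (≤-reflexive δt≡1+j)))))

      Top⇒¬unique-parent : ∀ {t p} → Top t → ¬ (∀ y → Parent G δ y t → y ≡ p)
      Top⇒¬unique-parent {t} t-top sole = no-light-top t t-top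
        (degree≤1⇒Light (degree≤1 G (λ z tz → sole z (tz , top-neighbour-below t-top tz))))

      deletable-light-parent : ∃ λ u → u ≢ v × Deletable G δ u × Light u
      deletable-light-parent with parent deepest (Top⇒≢root refl)
      ... | p , deepest-p , 1+δp≡e with δ p in δp≡
      ...   | zero = contradiction sole-root (Top⇒¬unique-parent refl)
        where
        sole-root : ∀ y → Parent G δ y deepest → y ≡ v
        sole-root y (_ , 1+δy≡e) = depth-zero⇒root (suc-injective (trans 1+δy≡e (sym 1+δp≡e)))
      ...   | suc j = p , p≢v , p-deletable , p-light
        where
        p≢v : p ≢ v
        p≢v refl = 1+n≢0 (trans (sym δp≡) root-depth)
        e≡2+j : δ deepest ≡ suc (suc j)
        e≡2+j = sym 1+δp≡e
        p-light : Light p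
        p-light = Light-from δp≡ (neighbour-of-heavy deepest-p
          (λ z deepest-z → <⇒≤ (neighbour-depth e≡2+j z deepest-z)) (neighbour-depth δp≡)
          (¬Light-bound (no-light-top deepest refl) (≤-reflexive e≡2+j)))
        p-deletable : Deletable G δ p
        p-deletable with soleParent? G δ p
        ... | no no-sole = ¬SoleParent⇒Deletable G δ p no-sole
        ... | yes (w , (_ , 1+δp≡δw) , sole) =
          contradiction sole (Top⇒¬unique-parent (trans (sym 1+δp≡δw) (trans (cong suc δp≡) (sym e≡2+j))))

    deletable-light-vertex : ∃ λ u → u ≢ v × Deletable G δ u × Light u
    deletable-light-vertex with any? (λ t → (δ t ≟ δ deepest) ×-dec light? t)
    ... | yes (t , t-top , t-light) = t , Top⇒≢root t-top , Top⇒Deletable t-top , t-light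
    ... | no ∄light-top = NoLightTop.deletable-light-parent (λ t t-top t-light → ∄light-top (t , t-top , t-light))

transmission+degreeSum-bound : ∀ k (G : SimpleGraph (suc k)) → TriangleFree G →
                               ∀ {v δ} → IsBFSLayering G v δ → 2 * (∑ δ + degreeSum G) ≤ k * (k + 5)
transmission+degreeSum-bound zero G _ {zero} L rewrite IsBFSLayering.root-depth L | irrefl G zero = z≤n
transmission+degreeSum-bound (suc k) G tf {v} {δ} L = delete (deletable-light-vertex (punchInᵢ≢i v zero))
  where
  open DeletableLightVertex G tf L using (Light; deletable-light-vertex)
  delete : (∃ λ u → u ≢ v × Deletable G δ u × Light u) → 2 * (∑ δ + degreeSum G) ≤ suc k * (suc k + 5)
  delete (u , u≢v , u-deletable , u-light) = begin
    2 * (∑ δ + degreeSum G)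
      ≡⟨ cong₂ (λ a b → 2 * (a + b)) (sum-remove {i = u} δ) (degreeSum-removeVertex G u) ⟩
    2 * ((δ u + ∑ δ′) + (degreeSum G′ + 2 * degree G u))
      ≡⟨ regroup (δ u) (∑ δ′) (degreeSum G′) (degree G u) ⟩
    2 * (∑ δ′ + degreeSum G′) + 2 * (2 * degree G u + δ u)
      ≤⟨ +-mono-≤ induction-hypothesis (*-monoʳ-≤ 2 u-light) ⟩
    k * (k + 5) + 2 * (3 + k)
      ≡⟨ grow k ⟩
    suc k * (suc k + 5)
      ∎
    where
    open ≤-Reasoning
    G′ : SimpleGraph (suc k)
    G′ = removeVertex G u
    δ′ : Fin (suc k) → ℕ
    δ′ = δ ∘ punchIn u
    induction-hypothesis : 2 * (∑ δ′ + degreeSum G′) ≤ k * (k + 5)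
    induction-hypothesis = transmission+degreeSum-bound k G′ (TriangleFree-removeVertex {G = G} u tf)
                                                        (removeVertex-IsBFSLayering L u≢v u-deletable)
    regroup : ∀ x S D d → 2 * ((x + S) + (D + 2 * d)) ≡ 2 * (S + D) + 2 * (2 * d + x)
    regroup = solve-∀
    grow : ∀ k → k * (k + 5) + 2 * (3 + k) ≡ suc k * (suc k + 5)
    grow = solve-∀

p+r≤q⇒p≤q-r : ∀ {p q r} → p +ℚ r ≤ℚ q → p ≤ℚ q -ℚ r
p+r≤q⇒p≤q-r {p} {q} {r} p+r≤q = begin
  p                  ≡⟨ QP.+-identityʳ p ⟨
  p +ℚ 0ℚ            ≡⟨ cong (p +ℚ_) (QP.+-inverseʳ r) ⟨
  p +ℚ (r -ℚ r)      ≡⟨ QP.+-assoc p r (Q.- r) ⟨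
  p +ℚ r -ℚ r        ≤⟨ QP.+-monoˡ-≤ (Q.- r) p+r≤q ⟩
  q -ℚ r             ∎
  where open QP.≤-Reasoning

toℚᵘ-/ℕ : ∀ a b → Q.toℚᵘ (a /ℕ suc b) U.≃ mkℚᵘ (ℤ.+ a) b
toℚᵘ-/ℕ a b = QP.toℚᵘ-fromℚᵘ (mkℚᵘ (ℤ.+ a) b)

mean-bound : ∀ σ M k → 2 * (σ + M) ≤ suc k * (suc k + 5) →
             σ /ℕ suc k ≤ℚ (suc (suc k) /ℕ 2 +ℚ 2 /ℕ 1) -ℚ M /ℕ suc k
mean-bound σ M k bound = p+r≤q⇒p≤q-r (QP.toℚᵘ-cancel-≤ (begin
  Q.toℚᵘ (σ /ℕ K +ℚ M /ℕ K)                     ≃⟨ QP.toℚᵘ-homo-+ (σ /ℕ K) (M /ℕ K) ⟩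
  Q.toℚᵘ (σ /ℕ K) U.+ Q.toℚᵘ (M /ℕ K)           ≃⟨ UP.+-cong (toℚᵘ-/ℕ σ k) (toℚᵘ-/ℕ M k) ⟩
  mkℚᵘ (ℤ.+ σ) k U.+ mkℚᵘ (ℤ.+ M) k             ≤⟨ U.*≤* (subst₂ ℤ._≤_ lhs rhs (ℤ.+≤+ cross-multiplied)) ⟩
  mkℚᵘ (ℤ.+ suc K) 1 U.+ mkℚᵘ (ℤ.+ 2) 0         ≃⟨ UP.+-cong (toℚᵘ-/ℕ (suc K) 1) (toℚᵘ-/ℕ 2 0) ⟨
  Q.toℚᵘ (suc K /ℕ 2) U.+ Q.toℚᵘ (2 /ℕ 1)       ≃⟨ QP.toℚᵘ-homo-+ (suc K /ℕ 2) (2 /ℕ 1) ⟨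
  Q.toℚᵘ (suc K /ℕ 2 +ℚ 2 /ℕ 1)                 ∎))
  where
  open UP.≤-Reasoning
  K : ℕ
  K = suc k
  cross-multiplied : (σ * K + M * K) * 2 ≤ (suc K * 1 + 2 * 2) * (K * K)
  cross-multiplied = subst₂ _≤_ (regroupˡ σ M K) (regroupʳ K) (*-monoˡ-≤ K bound)
    where
    regroupˡ : ∀ σ M K → 2 * (σ + M) * K ≡ (σ * K + M * K) * 2
    regroupˡ = solve-∀
    regroupʳ : ∀ K → K * (K + 5) * K ≡ (suc K * 1 + 2 * 2) * (K * K)
    regroupʳ = solve-∀
  -- U._≤_ compares ↥ p ℤ.* ↧ q with ↥ q ℤ.* ↧ p; lhs and rhs are these products for the sums above.
  lhs : ℤ.+ ((σ * K + M * K) * 2) ≡ ((ℤ.+ σ) ℤ.* (ℤ.+ K) ℤ.+ (ℤ.+ M) ℤ.* (ℤ.+ K)) ℤ.* (ℤ.+ 2)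
  lhs = trans (ZP.pos-* (σ * K + M * K) 2)
              (cong (ℤ._* (ℤ.+ 2)) (cong₂ ℤ._+_ (ZP.pos-* σ K) (ZP.pos-* M K)))
  rhs : ℤ.+ ((suc K * 1 + 2 * 2) * (K * K)) ≡
        ((ℤ.+ suc K) ℤ.* (ℤ.+ 1) ℤ.+ (ℤ.+ 2) ℤ.* (ℤ.+ 2)) ℤ.* (ℤ.+ (K * K))
  rhs = trans (ZP.pos-* (suc K * 1 + 2 * 2) (K * K))
              (cong (ℤ._* (ℤ.+ (K * K))) (cong₂ ℤ._+_ (ZP.pos-* (suc K) 1) (ZP.pos-* 2 2)))

foldr-⊔-lub : ∀ {A : Set} (f : A → ℚ) {r} → 0ℚ ≤ℚ r → (∀ x → f x ≤ℚ r) → ∀ xs → foldr Q._⊔_ 0ℚ (map f xs) ≤ℚ r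
foldr-⊔-lub f 0≤r f≤r []       = 0≤r
foldr-⊔-lub f 0≤r f≤r (x ∷ xs) = QP.⊔-lub (f≤r x) (foldr-⊔-lub f 0≤r f≤r xs)

mainTheorem10 : ∀ (n : ℕ) → 2 ≤ n → (G : SimpleGraph n) → Connected G → TriangleFree G →
                  (d : Fin n → Fin n → ℕ) → (∀ u v → IsDistance G u v (d u v)) →
                  remoteness d ≤ℚ ((n /ℕ 2) +ℚ (2 /ℕ 1)) -ℚ ((2 * size G) /ℕ (n ∸ 1))
mainTheorem10 (suc (suc k)) (s≤s (s≤s z≤n)) G _ tf d isDistance =
  foldr-⊔-lub (avgDist d) (QP.≤-trans avgDist-nonNeg (avgDist≤bound zero)) avgDist≤bound (allFin _)
  where
  transmission : Fin (suc (suc k)) → ℕ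
  transmission v = sum (map (d v) (allFin _))
  avgDist≤bound : ∀ v → avgDist d v ≤ℚ (suc (suc k) /ℕ 2 +ℚ 2 /ℕ 1) -ℚ (2 * size G) /ℕ suc k
  avgDist≤bound v = mean-bound (transmission v) (2 * size G) k
    (subst (_≤ suc k * (suc k + 5)) (cong₂ (λ σ D → 2 * (σ + D)) (sym (sum-map-allFin (d v))) (handshake G))
      (transmission+degreeSum-bound (suc k) G tf (distance-IsBFSLayering d isDistance v)))
  avgDist-nonNeg : 0ℚ ≤ℚ avgDist d zero
  avgDist-nonNeg = QP.nonNegative⁻¹ _ {{QP.normalize-nonNeg (transmission zero) (suc k)}}
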